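{- Let $\mathcal{C}$ be a clutter on $X=\{x_1,\dots,x_n\}$ whose edge ideal $I=I(\mathcal{C})\subset k[x_1,\dots,x_n]$ is minimally generated by squarefree monomials $x^{v_1},\dots,x^{v_q}$, and suppose $x_n$ is a free variable of $I$ occurring in $x^{v_q}$; write $x^{v_q}=x_nx^u$. (a) Let $\mathcal{C}_1$ be the clutter associated to $J=(x^{v_1},\dots,x^{v_{q-1}})$. Then $C$ is a minimal vertex cover of $\mathcal{C}$ containing $x_n$ if and only if $C\cap\operatorname{supp}(x^u)=\emptyset$ and $C=\{x_n\}\cup C'$ for some minimal vertex cover $C'$ of $\mathcal{C}_1$. (b) Let $\mathcal{C}_2$ be the clutter associated to $L=(x^{v_1},\dots,x^{v_{q-1}},x^u)$. Then $C$ is a minimal vertex cover of $\mathcal{C}$ not containing $x_n$ if and only if $C$ is a minimal vertex cover of $\mathcal{C}_2$.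
   Context: A clutter on $X$ is a family of subsets of $X$ (edges) none contained in another; the clutter associated to an ideal generated by squarefree monomials has as edges the supports (sets of variables occurring) of its minimal squarefree monomial generators. A variable is free in $I$ if it occurs in exactly one of the minimal generators $x^{v_1},\dots,x^{v_q}$. A vertex cover is a subset of $X$ meeting every edge; it is minimal if no proper subset is a vertex cover. -}

module Defs where

open import Data.Nat using (ℕ; zero; suc)
open import Data.Fin using (Fin; zero; suc)
open import Data.Fin.Subset using (Subset; _∈_; _⊆_; _⊂_; _∩_; Nonempty)
open import Data.Product using (Σ; ∃; _×_)
open import Relation.Binary.PropositionalEquality using (_≡_; _≢_)
open import Relation.Nullary using (¬_)

-- Vertices X = {x_1,…,x_n} are Fin n; a squarefree monomial x^v is
-- identified with its support, a Subset n.

Family : ℕ → Set₁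
Family n = Subset n → Set

MinimalGenerators : ∀ {n q} → (Fin q → Subset n) → Set
MinimalGenerators v = ∀ i j → i ≢ j → ¬ (v i ⊆ v j)

-- Clutter associated to the ideal generated by the squarefree monomials
-- x^{v_1},…,x^{v_q}: its edges are the supports of the minimal monomial
-- generators, i.e. the supports v_i not strictly dividable by another v_j.
assocClutter : ∀ {n q} → (Fin q → Subset n) → Family n
assocClutter {q = q} v E = (∃ λ (i : Fin q) → v i ≡ E) × (∀ j → v j ⊆ E → v j ≡ E)

FreeIn : ∀ {n q} → Fin n → (Fin q → Subset n) → Fin q → Set
FreeIn x v i = x ∈ v i × (∀ j → x ∈ v j → j ≡ i)

IsVertexCover : ∀ {n} → Family n → Subset n → Set
IsVertexCover F C = ∀ E → F E → Nonempty (C ∩ E)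

IsMinimalVertexCover : ∀ {n} → Family n → Subset n → Set
IsMinimalVertexCover F C = IsVertexCover F C × (∀ D → D ⊂ C → ¬ IsVertexCover F D)

withLast : ∀ {A : Set} {p} → (Fin p → A) → A → Fin (suc p) → A
withLast {p = zero} f a zero = a
withLast {p = suc p} f a zero = f zero
withLast {p = suc p} f a (suc i) = withLast (λ k → f (suc k)) a i

{-# OPTIONS --safe #-}
module Submission where

-- Covering the clutter of the supports v₁,…,v_q is the same as meeting every vᵢ,
-- since each vᵢ contains an edge. The generators other than v_q = {xₙ} ∪ u avoid
-- the free variable xₙ, so the covers of 𝒞 are the covers of 𝒞₁ that contain xₙ
-- or meet u, and those of 𝒞₂ are the covers of 𝒞₁ that meet u. A minimal cover
-- containing xₙ cannot meet u (otherwise xₙ could be dropped), and removing xₙ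
-- from it leaves a minimal cover of 𝒞₁. A minimal cover of 𝒞₂ never contains xₙ,
-- which lies in none of the generators of L.

open import Defs
open import Data.Nat using (ℕ; suc)
open import Data.Fin using (Fin; fromℕ; inject₁)
open import Data.Fin.Subset using (Subset; _∈_; _∉_; _∪_; _∩_; ⁅_⁆; Empty)
open import Data.Product using (∃; _×_)
open import Function.Bundles using (_⇔_)
open import Relation.Binary.PropositionalEquality using (_≡_)

open import Data.Fin using (zero; suc; _≟_)
open import Data.Fin.Properties using (any?; fromℕ≢inject₁)
open import Data.Fin.Subset using (_⊆_; _⊂_; _⊄_; _-_; Nonempty)
open import Data.Fin.Subset.Properties
  using ( x∈p∩q⁺; x∈p∩q⁻; x∈p∪q⁺; x∈p∪q⁻; x∈⁅x⁆; x∈⁅y⁆⇒x≡y; _∈?_; _⊂?_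
        ; ⊆-refl; ⊆-trans; ⊆-antisym; p⊂q⇒p⊆q; q⊆p∪q; p─q⊆p
        ; x∈p∧x≢y⇒x∈p-y; x∈p⇒p-x⊂p )
open import Data.Fin.Subset.Induction using (Acc; acc; ⊂-wellFounded)
open import Data.Product using (_,_; proj₁; proj₂)
open import Data.Vec.Base using (_∷_; there)
open import Data.Sum using (_⊎_; inj₁; inj₂)
open import Function.Bundles using (mk⇔; Equivalence)
open import Relation.Binary.PropositionalEquality using (_≢_; refl; sym; subst)
open import Relation.Nullary using (¬_; yes; no; contradiction)
open import Relation.Nullary.Decidable using (decidable-stable)

open Equivalence using (to; from)

private
  variable
    n k : ℕ
    x y : Fin n
    p q C D E E′ : Subset n

x∉p-x : x ∉ p - x
x∉p-x {x = zero}  {_ ∷ p} ()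
x∉p-x {x = suc x} {_ ∷ p} (there x∈p-x) = x∉p-x x∈p-x

x∈p-y⇒x≢y : x ∈ p - y → x ≢ y
x∈p-y⇒x≢y x∈p-x refl = x∉p-x x∈p-x

x∈⁅y⁆∪p∧x≢y⇒x∈p : x ∈ ⁅ y ⁆ ∪ p → x ≢ y → x ∈ p
x∈⁅y⁆∪p∧x≢y⇒x∈p {y = y} {p = p} x∈⁅y⁆∪p x≢y with x∈p∪q⁻ ⁅ y ⁆ p x∈⁅y⁆∪p
... | inj₁ x∈⁅y⁆ = contradiction (x∈⁅y⁆⇒x≡y y x∈⁅y⁆) x≢y
... | inj₂ x∈p   = x∈p

x∈q∧p⊆q⇒⁅x⁆∪p⊆q : x ∈ q → p ⊆ q → ⁅ x ⁆ ∪ p ⊆ q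
x∈q∧p⊆q⇒⁅x⁆∪p⊆q {x = x} {q = q} {p = p} x∈q p⊆q y∈⁅x⁆∪p with x∈p∪q⁻ ⁅ x ⁆ p y∈⁅x⁆∪p
... | inj₁ y∈⁅x⁆ = subst (_∈ q) (sym (x∈⁅y⁆⇒x≡y x y∈⁅x⁆)) x∈q
... | inj₂ y∈p   = p⊆q y∈p

x∈p⇒p≡⁅x⁆∪p-x : x ∈ p → p ≡ ⁅ x ⁆ ∪ (p - x)
x∈p⇒p≡⁅x⁆∪p-x {x = x} {p = p} x∈p =
  ⊆-antisym p⊆⁅x⁆∪p-x (x∈q∧p⊆q⇒⁅x⁆∪p⊆q x∈p (p─q⊆p p ⁅ x ⁆))
  where
  p⊆⁅x⁆∪p-x : p ⊆ ⁅ x ⁆ ∪ (p - x)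
  p⊆⁅x⁆∪p-x {y} y∈p with y ≟ x
  ... | yes refl = x∈p∪q⁺ (inj₁ (x∈⁅x⁆ x))
  ... | no y≢x   = x∈p∪q⁺ (inj₂ (x∈p∧x≢y⇒x∈p-y y∈p y≢x))

x∈q∧p⊂q-x⇒⁅x⁆∪p⊂q : x ∈ q → p ⊂ q - x → ⁅ x ⁆ ∪ p ⊂ q
x∈q∧p⊂q-x⇒⁅x⁆∪p⊂q {x = x} {q = q} x∈q (p⊆q-x , z , z∈q-x , z∉p) =
  x∈q∧p⊆q⇒⁅x⁆∪p⊆q x∈q (λ y∈p → p─q⊆p q ⁅ x ⁆ (p⊆q-x y∈p)) ,
  z , p─q⊆p q ⁅ x ⁆ z∈q-x ,
  λ z∈⁅x⁆∪p → z∉p (x∈⁅y⁆∪p∧x≢y⇒x∈p z∈⁅x⁆∪p (x∈p-y⇒x≢y z∈q-x))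

x∈p∧p⊂⁅x⁆∪q⇒p-x⊂q : x ∈ p → p ⊂ ⁅ x ⁆ ∪ q → p - x ⊂ q
x∈p∧p⊂⁅x⁆∪q⇒p-x⊂q {x = x} {p = p} x∈p (p⊆⁅x⁆∪q , z , z∈⁅x⁆∪q , z∉p) =
  (λ y∈p-x → x∈⁅y⁆∪p∧x≢y⇒x∈p (p⊆⁅x⁆∪q (p─q⊆p p ⁅ x ⁆ y∈p-x)) (x∈p-y⇒x≢y y∈p-x)) ,
  z , x∈⁅y⁆∪p∧x≢y⇒x∈p z∈⁅x⁆∪q z≢x , λ z∈p-x → z∉p (p─q⊆p p ⁅ x ⁆ z∈p-x)
  where
  z≢x : z ≢ x
  z≢x refl = z∉p x∈p

p⊆q∧p⊄q⇒p≡q : p ⊆ q → p ⊄ q → p ≡ q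
p⊆q∧p⊄q⇒p≡q {p = p} p⊆q p⊄q = ⊆-antisym p⊆q λ {y} y∈q →
  decidable-stable (y ∈? p) λ y∉p → p⊄q (p⊆q , y , y∈q , y∉p)

Meets : Subset n → Subset n → Set
Meets C E = Nonempty (C ∩ E)

meets-mono : C ⊆ D → E ⊆ E′ → Meets C E → Meets D E′
meets-mono {C = C} {E = E} C⊆D E⊆E′ (y , h) =
  let y∈C , y∈E = x∈p∩q⁻ C E h in y , x∈p∩q⁺ (C⊆D y∈C , E⊆E′ y∈E)

meets-remove : x ∉ E → Meets C E → Meets (C - x) E
meets-remove {E = E} {C = C} x∉E (y , h) =
  let y∈C , y∈E = x∈p∩q⁻ C E h
  in y , x∈p∩q⁺ (x∈p∧x≢y⇒x∈p-y y∈C (λ { refl → x∉E y∈E }) , y∈E)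

meets-⁅x⁆∪⁻ : Meets C (⁅ x ⁆ ∪ E) → x ∈ C ⊎ Meets C E
meets-⁅x⁆∪⁻ {C = C} {x = x} {E = E} (y , h) with x∈p∩q⁻ C (⁅ x ⁆ ∪ E) h
... | y∈C , y∈⁅x⁆∪E with x∈p∪q⁻ ⁅ x ⁆ E y∈⁅x⁆∪E
...   | inj₁ y∈⁅x⁆ = inj₁ (subst (_∈ C) (x∈⁅y⁆⇒x≡y x y∈⁅x⁆) y∈C)
...   | inj₂ y∈E   = inj₂ (y , x∈p∩q⁺ (y∈C , y∈E))

vertexCover-mono : ∀ {F : Family n} → C ⊆ D → IsVertexCover F C → IsVertexCover F D
vertexCover-mono C⊆D cover E e = meets-mono C⊆D ⊆-refl (cover E e)

vertexCover-remove : ∀ {F : Family n} → (∀ E → F E → x ∉ E) →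
                     IsVertexCover F C → IsVertexCover F (C - x)
vertexCover-remove x∉F cover E e = meets-remove (x∉F E e) (cover E e)

edge⊆generator : (g : Fin k → Subset n) (i : Fin k) →
                 ∃ λ E → assocClutter g E × E ⊆ g i
edge⊆generator g i = go i (⊂-wellFounded (g i))
  where
  go : ∀ i → Acc _⊂_ (g i) → ∃ λ E → assocClutter g E × E ⊆ g i
  go i (acc rec) with any? (λ j → g j ⊂? g i)
  ... | yes (j , gⱼ⊂gᵢ) =
    let E , e , E⊆gⱼ = go j (rec gⱼ⊂gᵢ) in E , e , ⊆-trans E⊆gⱼ (p⊂q⇒p⊆q gⱼ⊂gᵢ)
  ... | no ∄gⱼ⊂gᵢ =
    g i , ((i , refl) , λ j gⱼ⊆gᵢ → p⊆q∧p⊄q⇒p≡q gⱼ⊆gᵢ (λ gⱼ⊂gᵢ → ∄gⱼ⊂gᵢ (j , gⱼ⊂gᵢ))) ,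
    ⊆-refl

vertexCover⇔meetsAll : (g : Fin k → Subset n) (C : Subset n) →
                       IsVertexCover (assocClutter g) C ⇔ (∀ i → Meets C (g i))
vertexCover⇔meetsAll g C = mk⇔ meetsAll cover
  where
  meetsAll : IsVertexCover (assocClutter g) C → ∀ i → Meets C (g i)
  meetsAll cover i =
    let E , e , E⊆gᵢ = edge⊆generator g i in meets-mono ⊆-refl E⊆gᵢ (cover E e)
  cover : (∀ i → Meets C (g i)) → IsVertexCover (assocClutter g) C
  cover meetsAll E ((i , refl) , _) = meetsAll i

∀-fromℕ-inject₁ : ∀ {P : Fin (suc k) → Set} →
                  P (fromℕ k) → (∀ i → P (inject₁ i)) → ∀ i → P i
∀-fromℕ-inject₁ {k = ℕ.zero}  last init zero    = last
∀-fromℕ-inject₁ {k = suc k}   last init zero    = init zero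
∀-fromℕ-inject₁ {k = suc k} {P} last init (suc i) =
  ∀-fromℕ-inject₁ {P = λ i → P (suc i)} last (λ i → init (suc i)) i

withLast-fromℕ : ∀ {A : Set} (f : Fin k → A) a → withLast f a (fromℕ k) ≡ a
withLast-fromℕ {k = ℕ.zero} f a = refl
withLast-fromℕ {k = suc k}  f a = withLast-fromℕ (λ i → f (suc i)) a

withLast-inject₁ : ∀ {A : Set} (f : Fin k → A) a i → withLast f a (inject₁ i) ≡ f i
withLast-inject₁ {k = suc k} f a zero    = refl
withLast-inject₁ {k = suc k} f a (suc i) = withLast-inject₁ (λ i → f (suc i)) a i

vertexCover-snoc : (g : Fin (suc k) → Subset n) (f : Fin k → Subset n) →
                   g (fromℕ k) ≡ E → (∀ i → g (inject₁ i) ≡ f i) → ∀ C →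
                   IsVertexCover (assocClutter g) C ⇔
                   (Meets C E × IsVertexCover (assocClutter f) C)
vertexCover-snoc g f last init C = mk⇔
  (λ cover → let meetsAll = to (vertexCover⇔meetsAll g C) cover in
    subst (Meets C) last (meetsAll (fromℕ _)) ,
    from (vertexCover⇔meetsAll f C) (λ i → subst (Meets C) (init i) (meetsAll (inject₁ i))))
  (λ (meetsE , cover) → from (vertexCover⇔meetsAll g C) (∀-fromℕ-inject₁
    (subst (Meets C) (sym last) meetsE)
    (λ i → subst (Meets C) (sym (init i)) (to (vertexCover⇔meetsAll f C) cover i))))

module _ {x : Fin n} {u : Subset n} {F F₁ : Family n}
         (x∉u : x ∉ u) (x∉F₁ : ∀ E → F₁ E → x ∉ E)
         (cover⇔ : ∀ C → IsVertexCover F C ⇔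
                         (Meets C (⁅ x ⁆ ∪ u) × IsVertexCover F₁ C))
         where

  private
    x∈C⇒cover : x ∈ C → IsVertexCover F₁ C → IsVertexCover F C
    x∈C⇒cover {C} x∈C cover₁ =
      from (cover⇔ C) ((x , x∈p∩q⁺ (x∈C , x∈p∪q⁺ (inj₁ (x∈⁅x⁆ x)))) , cover₁)

    meetsU⇒cover : Meets C u → IsVertexCover F₁ C → IsVertexCover F C
    meetsU⇒cover {C} meetsU cover₁ =
      from (cover⇔ C) (meets-mono ⊆-refl (q⊆p∪q ⁅ x ⁆ u) meetsU , cover₁)

    cover⇒cover₁ : IsVertexCover F C → IsVertexCover F₁ C
    cover⇒cover₁ {C} cover = proj₂ (to (cover⇔ C) cover)

    x∈C⊎meetsU : IsVertexCover F C → x ∈ C ⊎ Meets C u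
    x∈C⊎meetsU {C} cover = meets-⁅x⁆∪⁻ (proj₁ (to (cover⇔ C) cover))

  minimalVertexCover-∋ :
    ∀ C → (IsMinimalVertexCover F C × x ∈ C) ⇔
          (Empty (C ∩ u) × ∃ λ C′ → IsMinimalVertexCover F₁ C′ × C ≡ ⁅ x ⁆ ∪ C′)
  minimalVertexCover-∋ C = mk⇔ split join
    where
    split : IsMinimalVertexCover F C × x ∈ C →
            Empty (C ∩ u) × ∃ λ C′ → IsMinimalVertexCover F₁ C′ × C ≡ ⁅ x ⁆ ∪ C′
    split ((cover , minimal) , x∈C) =
      (λ meetsU → minimal (C - x) (x∈p⇒p-x⊂p x∈C)
                    (meetsU⇒cover (meets-remove x∉u meetsU) cover₁C-x)) ,
      C - x , (cover₁C-x , minimal₁) , x∈p⇒p≡⁅x⁆∪p-x x∈C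
      where
      cover₁C-x : IsVertexCover F₁ (C - x)
      cover₁C-x = vertexCover-remove x∉F₁ (cover⇒cover₁ cover)
      minimal₁ : ∀ D → D ⊂ C - x → ¬ IsVertexCover F₁ D
      minimal₁ D D⊂C-x cover₁D =
        minimal (⁅ x ⁆ ∪ D) (x∈q∧p⊂q-x⇒⁅x⁆∪p⊂q x∈C D⊂C-x)
          (x∈C⇒cover (x∈p∪q⁺ (inj₁ (x∈⁅x⁆ x))) (vertexCover-mono (q⊆p∪q ⁅ x ⁆ D) cover₁D))
    join : Empty (C ∩ u) × (∃ λ C′ → IsMinimalVertexCover F₁ C′ × C ≡ ⁅ x ⁆ ∪ C′) →
           IsMinimalVertexCover F C × x ∈ C
    join (C∩u-empty , C′ , (cover₁C′ , minimal₁) , refl) =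
      (x∈C⇒cover x∈C (vertexCover-mono (q⊆p∪q ⁅ x ⁆ C′) cover₁C′) , minimal) , x∈C
      where
      x∈C : x ∈ ⁅ x ⁆ ∪ C′
      x∈C = x∈p∪q⁺ (inj₁ (x∈⁅x⁆ x))
      minimal : ∀ D → D ⊂ ⁅ x ⁆ ∪ C′ → ¬ IsVertexCover F D
      minimal D D⊂C cover with x∈C⊎meetsU cover
      ... | inj₁ x∈D    = minimal₁ (D - x) (x∈p∧p⊂⁅x⁆∪q⇒p-x⊂q x∈D D⊂C)
                            (vertexCover-remove x∉F₁ (cover⇒cover₁ cover))
      ... | inj₂ meetsU = C∩u-empty (meets-mono (p⊂q⇒p⊆q D⊂C) ⊆-refl meetsU)

  minimalVertexCover-∌ :
    ∀ {F₂ : Family n} →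
    (∀ C → IsVertexCover F₂ C ⇔ (Meets C u × IsVertexCover F₁ C)) →
    ∀ C → (IsMinimalVertexCover F C × x ∉ C) ⇔ IsMinimalVertexCover F₂ C
  minimalVertexCover-∌ {F₂} cover₂⇔ C = mk⇔ split join
    where
    x∉D⇒cover₂ : ∀ {D} → x ∉ D → IsVertexCover F D → IsVertexCover F₂ D
    x∉D⇒cover₂ {D} x∉D cover with x∈C⊎meetsU cover
    ... | inj₁ x∈D    = contradiction x∈D x∉D
    ... | inj₂ meetsU = from (cover₂⇔ D) (meetsU , cover⇒cover₁ cover)
    cover₂⇒cover : ∀ {D} → IsVertexCover F₂ D → IsVertexCover F D
    cover₂⇒cover {D} cover₂ = let meetsU , cover₁ = to (cover₂⇔ D) cover₂ in
      meetsU⇒cover meetsU cover₁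
    split : IsMinimalVertexCover F C × x ∉ C → IsMinimalVertexCover F₂ C
    split ((cover , minimal) , x∉C) =
      x∉D⇒cover₂ x∉C cover , λ D D⊂C cover₂D → minimal D D⊂C (cover₂⇒cover cover₂D)
    join : IsMinimalVertexCover F₂ C → IsMinimalVertexCover F C × x ∉ C
    join (cover₂ , minimal₂) = (cover₂⇒cover cover₂ , minimal) , x∉C
      where
      x∉C : x ∉ C
      x∉C x∈C = let meetsU , cover₁ = to (cover₂⇔ C) cover₂ in
        minimal₂ (C - x) (x∈p⇒p-x⊂p x∈C) (from (cover₂⇔ (C - x))
          (meets-remove x∉u meetsU , vertexCover-remove x∉F₁ cover₁))
      minimal : ∀ D → D ⊂ C → ¬ IsVertexCover F D
      minimal D D⊂C cover =
        minimal₂ D D⊂C (x∉D⇒cover₂ (λ x∈D → x∉C (p⊂q⇒p⊆q D⊂C x∈D)) cover)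

lemma5p2 : (m p : ℕ) (v : Fin (suc p) → Subset (suc m)) (u : Subset (suc m))
  → MinimalGenerators v
  → FreeIn (fromℕ m) v (fromℕ p)
  → v (fromℕ p) ≡ ⁅ fromℕ m ⁆ ∪ u
  → fromℕ m ∉ u
  → let 𝒞  = assocClutter v
        𝒞₁ = assocClutter (λ i → v (inject₁ i))
        𝒞₂ = assocClutter (withLast (λ i → v (inject₁ i)) u)
    in (∀ (C : Subset (suc m))
          → (IsMinimalVertexCover 𝒞 C × fromℕ m ∈ C)
            ⇔ (Empty (C ∩ u)
               × ∃ λ C′ → IsMinimalVertexCover 𝒞₁ C′ × C ≡ ⁅ fromℕ m ⁆ ∪ C′))
     × (∀ (C : Subset (suc m))
          → (IsMinimalVertexCover 𝒞 C × fromℕ m ∉ C)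
            ⇔ IsMinimalVertexCover 𝒞₂ C)
lemma5p2 m p v u _ (_ , onlyInLast) vₚ≡⁅x⁆∪u x∉u =
  minimalVertexCover-∋ x∉u x∉𝒞₁ cover𝒞⇔ ,
  minimalVertexCover-∌ x∉u x∉𝒞₁ cover𝒞⇔ cover𝒞₂⇔
  where
  w : Fin p → Subset (suc m)
  w i = v (inject₁ i)
  x∉𝒞₁ : ∀ E → assocClutter w E → fromℕ m ∉ E
  x∉𝒞₁ E ((i , refl) , _) x∈wᵢ = fromℕ≢inject₁ (sym (onlyInLast (inject₁ i) x∈wᵢ))
  cover𝒞⇔ : ∀ C → IsVertexCover (assocClutter v) C ⇔
                   (Meets C (⁅ fromℕ m ⁆ ∪ u) × IsVertexCover (assocClutter w) C)
  cover𝒞⇔ = vertexCover-snoc v w vₚ≡⁅x⁆∪u (λ _ → refl)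
  cover𝒞₂⇔ : ∀ C → IsVertexCover (assocClutter (withLast w u)) C ⇔
                    (Meets C u × IsVertexCover (assocClutter w) C)
  cover𝒞₂⇔ = vertexCover-snoc (withLast w u) w (withLast-fromℕ w u) (withLast-inject₁ w u)
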